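{- If $G$ is a threshold graph, then $\varepsilon(G)$ is pancyclic.
   Context: A threshold graph is a graph obtainable from a single vertex by repeatedly adding either an isolated vertex or a universal vertex (one adjacent to all existing vertices). A dominating set of a graph $G$ is a set $D\subseteq V(G)$ such that every vertex of $V(G)\setminus D$ has a neighbour in $D$. The TARS-graph $\varepsilon(G)$ has as vertices the dominating sets of $G$; two distinct dominating sets $X,Y$ are adjacent iff either (i) $Y$ is obtained from $X$ by adding or deleting a single vertex of $G$, or (ii) there are vertices $u\in X$ and $v\in Y\setminus X$ that are adjacent in $G$ with $Y=(X\cup\{v\})\setminus\{u\}$. A graph on $N$ vertices is pancyclic if it contains a cycle of length $\ell$ for every integer $\ell$ with $3\le \ell\le N$ (vacuously true if $N\le 2$). -}

module Defs where

open import Data.Nat using (ℕ; zero; suc; _≤_)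
open import Data.Fin using (Fin; zero; suc; inject₁; fromℕ)
open import Data.Fin.Subset using (Subset; _∈_; _∉_; _∪_; _-_; ⁅_⁆)
open import Data.Product using (Σ; ∃; ∃-syntax; _×_; _,_)
open import Data.Sum using (_⊎_)
open import Data.Empty using (⊥)
open import Data.Unit using (⊤)
open import Data.List using (List; length)
open import Data.List.Relation.Unary.Unique.Propositional using (Unique)
import Data.List.Membership.Propositional as LM
open import Relation.Nullary using (¬_)
open import Relation.Binary.PropositionalEquality using (_≡_; _≢_)
open import Function.Bundles using (_⇔_; _↔_; Inverse)

record Graph (n : ℕ) : Set₁ where
  field
    Adj   : Fin n → Fin n → Set
    sym   : ∀ {i j} → Adj i j → Adj j i
    irrefl : ∀ {i} → ¬ Adj i i
open Graph public

-- Construction sequences of threshold graphs: start from a single vertex,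
-- repeatedly add an isolated or a universal vertex.  The newly added vertex
-- is `zero`, the old vertices are shifted by `suc`.
data ThrSeq : ℕ → Set where
  single    : ThrSeq 1
  isolated  : ∀ {n} → ThrSeq n → ThrSeq (suc n)
  universal : ∀ {n} → ThrSeq n → ThrSeq (suc n)

thrAdj : ∀ {n} → ThrSeq n → Fin n → Fin n → Set
thrAdj single        _       _       = ⊥
thrAdj (isolated s)  zero    _       = ⊥
thrAdj (isolated s)  (suc i) zero    = ⊥
thrAdj (isolated s)  (suc i) (suc j) = thrAdj s i j
thrAdj (universal s) zero    zero    = ⊥
thrAdj (universal s) zero    (suc j) = ⊤
thrAdj (universal s) (suc i) zero    = ⊤
thrAdj (universal s) (suc i) (suc j) = thrAdj s i j

IsThreshold : ∀ {n} → Graph n → Set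
IsThreshold {n} G =
  Σ (ThrSeq n) λ s → Σ (Fin n ↔ Fin n) λ π →
    ∀ i j → (Adj G i j ⇔ thrAdj s (Inverse.to π i) (Inverse.to π j))

Dominating : ∀ {n} → Graph n → Subset n → Set
Dominating G D = ∀ v → v ∉ D → ∃[ u ] (u ∈ D × Adj G u v)

TarsStep : ∀ {n} → Graph n → Subset n → Subset n → Set
TarsStep {n} G X Y =
    (∃[ v ] (v ∉ X × Y ≡ X ∪ ⁅ v ⁆))
  ⊎ (∃[ v ] (v ∈ X × Y ≡ X - v))
  ⊎ (∃[ u ] ∃[ v ] (u ∈ X × v ∈ Y × v ∉ X × Adj G u v × Y ≡ (X ∪ ⁅ v ⁆) - u))

TarsAdj : ∀ {n} → Graph n → Subset n → Subset n → Set
TarsAdj G X Y = X ≢ Y × (TarsStep G X Y ⊎ TarsStep G Y X)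

-- A cycle of length (suc m) in ε(G): distinct dominating sets
-- c 0, …, c m with c i ~ c (i+1) and c m ~ c 0.
record TarsCycle {n} (G : Graph n) (m : ℕ) : Set where
  field
    c     : Fin (suc m) → Subset n
    dom   : ∀ i → Dominating G (c i)
    inj   : ∀ i j → c i ≡ c j → i ≡ j
    step  : ∀ (i : Fin m) → TarsAdj G (c (inject₁ i)) (c (suc i))
    close : TarsAdj G (c (fromℕ m)) (c zero)

-- L is a duplicate-free list of exactly the dominating sets of G
-- (so length L is the number of vertices of ε(G)).
EnumDom : ∀ {n} → Graph n → List (Subset n) → Set
EnumDom G L = Unique L × (∀ D → (D LM.∈ L ⇔ Dominating G D))

TarsPancyclic : ∀ {n} → Graph n → Set
TarsPancyclic G = ∀ (L : List (Subset _)) → EnumDom G L →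
  ∀ m → 3 ≤ suc m → suc m ≤ length L → TarsCycle G m

{-# OPTIONS --safe #-}
module Submission where

-- An isolated vertex lies in every
-- dominating set, so adding one does not change ε.  If the last vertex z is universal, the
-- dominating sets are the sets containing z together with the dominating sets of the rest;
-- adding or removing a vertex, and trading z for a vertex outside the set, are edges of ε.
-- By induction on the sequence, for every m from 2 to the number of dominating sets there is
-- a path on m dominating sets from V to V ∖ {v}, where v is the vertex added just before z;
-- the edge V ∖ {v} – V closes it to a cycle.  In the induction the sets are split by whether
-- they contain v: a path through one half, an edge across, and a reversed path through the
-- other half reach every length.  Each half is a family of the same shape (all sets, or the
-- dominating sets of a shorter sequence), except that when v is isolated the half avoiding v
-- is a hypercube, whose paths between adjacent corners have an even number of vertices.

open import Data.Bool.Properties using (∨-identityʳ)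
open import Data.Empty using (⊥; ⊥-elim)
open import Data.Fin using (Fin; zero; suc; inject₁; fromℕ)
open import Data.Fin.Subset
  using (Subset; inside; outside; _∈_; _∉_; _∪_; _─_; _-_; ⁅_⁆; Nonempty) renaming (⊤ to full)
open import Data.Fin.Subset.Properties using (∪-identityʳ; p─⊥≡p; x∈⁅x⁆; x∈⁅y⁆⇒x≡y; ⊆-antisym)
open import Data.List using (List; []; _∷_; _++_; map; reverse; length)
open import Data.List.Properties using (length-++; length-map; length-reverse; unfold-reverse)
import Data.List.Membership.Propositional as List
open import Data.List.Membership.Propositional.Properties using (∈-map⁺; ∈-map⁻; ∈-++⁺ˡ; ∈-++⁺ʳ; ∈-++⁻; ∈-∃++)
open import Data.List.Relation.Unary.Any using (here; there)
open import Data.List.Relation.Unary.All as All using (All; []; _∷_)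
import Data.List.Relation.Unary.All.Properties as All
open import Data.List.Relation.Unary.AllPairs using ([]; _∷_)
open import Data.List.Relation.Unary.Unique.Propositional using (Unique)
import Data.List.Relation.Unary.Unique.Propositional.Properties as Unique
open import Data.List.Relation.Binary.Permutation.Propositional using (↭-sym; ↭⇒↭ₛ)
open import Data.List.Relation.Binary.Permutation.Propositional.Properties using (↭-reverse; All-resp-↭)
import Data.List.Relation.Binary.Permutation.Setoid.Properties as Permutation
open import Data.Nat using (ℕ; zero; suc; _+_; _∸_; _^_; _≤_; z≤n; s≤s; s≤s⁻¹; _≤?_)
open import Data.Nat.Properties
  using ( ≤-refl; ≤-reflexive; ≤-trans; ≤-antisym; <⇒≤; ≰⇒>; <-irrefl; m≤n⇒m≤1+n; suc-injective
        ; +-comm; +-identityʳ; +-suc; +-mono-≤; m≤m+n; m≤n+m; m^n>0; ^-monoʳ-≤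
        ; m+n≤o⇒m≤o∸n; m+n≤o⇒n≤o; m≤n+o⇒m∸n≤o; m∸n+n≡m; m+[n∸m]≡n; m+n≤o⇒m≤o
        ; +-commutativeSemigroup; module ≤-Reasoning)
open import Data.Nat.Tactic.RingSolver using (solve-∀)
open import Algebra.Properties.CommutativeSemigroup +-commutativeSemigroup using (interchange; xy∙z≈xz∙y)
open import Data.Product using (∃-syntax; ∃₂; _×_; _,_; proj₁)
open import Data.Sum using (_⊎_; inj₁; inj₂; [_,_]) renaming (map to ⊎-map; swap to ⊎-swap)
open import Data.Unit using (⊤; tt)
open import Data.Vec using (Vec; []; _∷_; here; there; lookup; tabulate; zipWith; insertAt; removeAt)
open import Data.Vec.Properties
  using (∷-injectiveʳ; insertAt-lookup; removeAt-insertAt; lookup∘tabulate; lookup-zipWith; []=⇒lookup; lookup⇒[]=)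
open import Data.Vec.Relation.Binary.Pointwise.Extensional using (ext; Pointwise-≡⇒≡)
open import Function using (_∘_; id; _↔_; _⇔_; Inverse; Equivalence)
open import Function.Construct.Symmetry using (⇔-sym)
open import Function.Definitions using (Injective)
open import Function.Properties.Inverse using (↔-sym)
open import Relation.Nullary using (¬_; yes; no)
open import Relation.Binary.PropositionalEquality hiding ([_])

open import Defs hiding (sym)

data Walk {A : Set} (R : A → A → Set) : A → A → Set where
  end    : ∀ a → Walk R a a
  _∷⟨_⟩_ : ∀ a {b c} → R a b → Walk R b c → Walk R a c

infixr 5 _∷⟨_⟩_

module _ {A : Set} {R : A → A → Set} where

  vertices : ∀ {a b} → Walk R a b → List A
  vertices (end a)       = a ∷ []
  vertices (a ∷⟨ _ ⟩ w) = a ∷ vertices w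

  steps : ∀ {a b} → Walk R a b → ℕ
  steps (end _)       = 0
  steps (_ ∷⟨ _ ⟩ w) = suc (steps w)

  vertexAt : ∀ {a b} (w : Walk R a b) → Fin (suc (steps w)) → A
  vertexAt (end a)       zero    = a
  vertexAt (a ∷⟨ _ ⟩ w) zero    = a
  vertexAt (a ∷⟨ _ ⟩ w) (suc i) = vertexAt w i

  _++⟨_⟩_ : ∀ {a b c d} → Walk R a b → R b c → Walk R c d → Walk R a d
  end a          ++⟨ e ⟩ w′ = a ∷⟨ e ⟩ w′
  (a ∷⟨ e′ ⟩ w) ++⟨ e ⟩ w′ = a ∷⟨ e′ ⟩ (w ++⟨ e ⟩ w′)

  reverseʷ : (∀ {x y} → R x y → R y x) → ∀ {a b} → Walk R a b → Walk R b a
  reverseʷ R-sym (end a)       = end a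
  reverseʷ R-sym (a ∷⟨ e ⟩ w) = reverseʷ R-sym w ++⟨ R-sym e ⟩ end a

  vertices-++⟨⟩ : ∀ {a b c d} (w : Walk R a b) (e : R b c) (w′ : Walk R c d) →
                  vertices (w ++⟨ e ⟩ w′) ≡ vertices w ++ vertices w′
  vertices-++⟨⟩ (end a)       e w′ = refl
  vertices-++⟨⟩ (a ∷⟨ _ ⟩ w) e w′ = cong (a ∷_) (vertices-++⟨⟩ w e w′)

  vertices-reverseʷ : (R-sym : ∀ {x y} → R x y → R y x) → ∀ {a b} (w : Walk R a b) →
                      vertices (reverseʷ R-sym w) ≡ reverse (vertices w)
  vertices-reverseʷ R-sym (end a)       = refl
  vertices-reverseʷ R-sym (a ∷⟨ e ⟩ w) = begin
    vertices (reverseʷ R-sym w ++⟨ R-sym e ⟩ end a) ≡⟨ vertices-++⟨⟩ (reverseʷ R-sym w) (R-sym e) (end a) ⟩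
    vertices (reverseʷ R-sym w) ++ a ∷ []          ≡⟨ cong (_++ a ∷ []) (vertices-reverseʷ R-sym w) ⟩
    reverse (vertices w) ++ a ∷ []                 ≡⟨ unfold-reverse a (vertices w) ⟨
    reverse (a ∷ vertices w)                       ∎
    where open ≡-Reasoning

  length-vertices : ∀ {a b} (w : Walk R a b) → length (vertices w) ≡ suc (steps w)
  length-vertices (end _)       = refl
  length-vertices (_ ∷⟨ _ ⟩ w) = cong suc (length-vertices w)

  vertexAt-zero : ∀ {a b} (w : Walk R a b) → vertexAt w zero ≡ a
  vertexAt-zero (end _)       = refl
  vertexAt-zero (_ ∷⟨ _ ⟩ _) = refl

  vertexAt-last : ∀ {a b} (w : Walk R a b) → vertexAt w (fromℕ (steps w)) ≡ b
  vertexAt-last (end _)       = refl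
  vertexAt-last (_ ∷⟨ _ ⟩ w) = vertexAt-last w

  vertexAt-step : ∀ {a b} (w : Walk R a b) (i : Fin (steps w)) →
                  R (vertexAt w (inject₁ i)) (vertexAt w (suc i))
  vertexAt-step (a ∷⟨ e ⟩ w) zero    = subst (R a) (sym (vertexAt-zero w)) e
  vertexAt-step (_ ∷⟨ _ ⟩ w) (suc i) = vertexAt-step w i

  vertexAt-∈ : ∀ {a b} (w : Walk R a b) i → vertexAt w i List.∈ vertices w
  vertexAt-∈ (end _)       zero    = here refl
  vertexAt-∈ (_ ∷⟨ _ ⟩ w) zero    = here refl
  vertexAt-∈ (_ ∷⟨ _ ⟩ w) (suc i) = there (vertexAt-∈ w i)

  vertexAt-injective : ∀ {a b} (w : Walk R a b) → Unique (vertices w) → Injective _≡_ _≡_ (vertexAt w)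
  vertexAt-injective (end _)       _        {zero}  {zero}  _  = refl
  vertexAt-injective (_ ∷⟨ _ ⟩ w) _        {zero}  {zero}  _  = refl
  vertexAt-injective (_ ∷⟨ _ ⟩ w) (a∉ ∷ _) {zero}  {suc j} eq = ⊥-elim (All.lookup a∉ (vertexAt-∈ w j) eq)
  vertexAt-injective (_ ∷⟨ _ ⟩ w) (a∉ ∷ _) {suc i} {zero}  eq = ⊥-elim (All.lookup a∉ (vertexAt-∈ w i) (sym eq))
  vertexAt-injective (_ ∷⟨ _ ⟩ w) (_ ∷ u)  {suc i} {suc j} eq = cong suc (vertexAt-injective w u eq)

module _ {A B : Set} {R : A → A → Set} {R′ : B → B → Set} where

  mapʷ : (f : A → B) → (∀ {x y} → R x y → R′ (f x) (f y)) → ∀ {a b} → Walk R a b → Walk R′ (f a) (f b)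
  mapʷ f g (end a)       = end (f a)
  mapʷ f g (a ∷⟨ e ⟩ w) = f a ∷⟨ g e ⟩ mapʷ f g w

  vertices-mapʷ : (f : A → B) (g : ∀ {x y} → R x y → R′ (f x) (f y)) → ∀ {a b} (w : Walk R a b) →
                  vertices (mapʷ f g w) ≡ map f (vertices w)
  vertices-mapʷ f g (end a)       = refl
  vertices-mapʷ f g (a ∷⟨ _ ⟩ w) = cong (f a ∷_) (vertices-mapʷ f g w)

Unique-reverse : ∀ {A : Set} {xs : List A} → Unique xs → Unique (reverse xs)
Unique-reverse {A} {xs} = Permutation.Unique-resp-↭ (setoid A) (↭⇒↭ₛ (↭-sym (↭-reverse xs)))

All-reverse : ∀ {A : Set} {P : A → Set} {xs : List A} → All P xs → All P (reverse xs)
All-reverse {xs = xs} = All-resp-↭ (↭-sym (↭-reverse xs))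

Unique-⊆⇒length-≤ : ∀ {A : Set} {xs ys : List A} → Unique xs → (∀ {x} → x List.∈ xs → x List.∈ ys) →
                    length xs ≤ length ys
Unique-⊆⇒length-≤ {xs = []}     _        _     = z≤n
Unique-⊆⇒length-≤ {xs = x ∷ xs} (x∉ ∷ u) xs⊆ys with ∈-∃++ (xs⊆ys (here refl))
... | ys₁ , ys₂ , refl = begin
  suc (length xs)               ≤⟨ s≤s (Unique-⊆⇒length-≤ u xs⊆ys₁++ys₂) ⟩
  suc (length (ys₁ ++ ys₂))     ≡⟨ cong suc (length-++ ys₁) ⟩
  suc (length ys₁ + length ys₂) ≡⟨ +-suc (length ys₁) (length ys₂) ⟨
  length ys₁ + length (x ∷ ys₂) ≡⟨ length-++ ys₁ ⟨
  length (ys₁ ++ x ∷ ys₂)       ∎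
  where
  open ≤-Reasoning
  xs⊆ys₁++ys₂ : ∀ {y} → y List.∈ xs → y List.∈ ys₁ ++ ys₂
  xs⊆ys₁++ys₂ y∈xs with ∈-++⁻ ys₁ (xs⊆ys (there y∈xs))
  ... | inj₁ y∈ys₁         = ∈-++⁺ˡ y∈ys₁
  ... | inj₂ (here refl)   = ⊥-elim (All.lookup x∉ y∈xs refl)
  ... | inj₂ (there y∈ys₂) = ∈-++⁺ʳ ys₁ y∈ys₂

record Path {A : Set} (R : A → A → Set) (P : A → Set) (a b : A) (m : ℕ) : Set where
  constructor path
  field
    walk    : Walk R a b
    length≡ : length (vertices walk) ≡ m
    unique  : Unique (vertices walk)
    all     : All P (vertices walk)

module _ {A : Set} {R : A → A → Set} {P : A → Set} where

  Path-cast : ∀ {a b m m′} → m ≡ m′ → Path R P a b m → Path R P a b m′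
  Path-cast refl p = p

  Path-weaken : ∀ {P′ : A → Set} → (∀ {x} → P x → P′ x) → ∀ {a b m} → Path R P a b m → Path R P′ a b m
  Path-weaken h (path w len u ps) = path w len u (All.map h ps)

  Path-reverse : (∀ {x y} → R x y → R y x) → ∀ {a b m} → Path R P a b m → Path R P b a m
  Path-reverse R-sym (path w len u ps) = path
    (reverseʷ R-sym w)
    (trans (cong length vs) (trans (length-reverse (vertices w)) len))
    (subst Unique (sym vs) (Unique-reverse u))
    (subst (All P) (sym vs) (All-reverse ps))
    where vs = vertices-reverseʷ R-sym w

  Path-join : ∀ {Q : A → Set} → (∀ {x} → P x → Q x → ⊥) →
              ∀ {a b c d m m′} → Path R P a b m → R b c → Path R Q c d m′ →
              Path R (λ x → P x ⊎ Q x) a d (m + m′)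
  Path-join separated (path w len u ps) e (path w′ len′ u′ qs) = path
    (w ++⟨ e ⟩ w′)
    (trans (cong length vs) (trans (length-++ (vertices w)) (cong₂ _+_ len len′)))
    (subst Unique (sym vs) (Unique.++⁺ u u′ λ (x∈w , x∈w′) → separated (All.lookup ps x∈w) (All.lookup qs x∈w′)))
    (subst (All _) (sym vs) (All.++⁺ (All.map inj₁ ps) (All.map inj₂ qs)))
    where vs = vertices-++⟨⟩ w e w′

module _ {A B : Set} {R : A → A → Set} {R′ : B → B → Set} {P : A → Set} {P′ : B → Set} where

  Path-map : (f : A → B) → Injective _≡_ _≡_ f → (∀ {x y} → R x y → R′ (f x) (f y)) →
             (∀ {x} → P x → P′ (f x)) → ∀ {a b m} → Path R P a b m → Path R′ P′ (f a) (f b) m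
  Path-map f f-inj g h (path w len u ps) = path
    (mapʷ f g w)
    (trans (cong length vs) (trans (length-map f (vertices w)) len))
    (subst Unique (sym vs) (Unique.map⁺ f-inj u))
    (subst (All P′) (sym vs) (All.map⁺ (All.map h ps)))
    where vs = vertices-mapʷ f g w

split-≤-+ : ∀ {l₁ l₂ u₁ u₂ m} → l₁ ≤ u₁ → l₂ ≤ u₂ → l₁ + l₂ ≤ m → m ≤ u₁ + u₂ →
            ∃₂ λ m₁ m₂ → (l₁ ≤ m₁ × m₁ ≤ u₁) × (l₂ ≤ m₂ × m₂ ≤ u₂) × m ≡ m₁ + m₂
split-≤-+ {l₁} {l₂} {u₁} {u₂} {m} l₁≤u₁ l₂≤u₂ lo hi with m ≤? u₁ + l₂
... | yes m≤u₁+l₂ = m ∸ l₂ , l₂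
                  , (m+n≤o⇒m≤o∸n l₁ lo , m≤n+o⇒m∸n≤o m l₂ (≤-trans m≤u₁+l₂ (≤-reflexive (+-comm u₁ l₂))))
                  , (≤-refl , l₂≤u₂) , sym (m∸n+n≡m (m+n≤o⇒n≤o l₁ lo))
... | no  m≰u₁+l₂ = u₁ , m ∸ u₁ , (l₁≤u₁ , ≤-refl)
                  , (m+n≤o⇒m≤o∸n l₂ (≤-trans (≤-reflexive (+-comm l₂ u₁)) (<⇒≤ (≰⇒> m≰u₁+l₂))) , m≤n+o⇒m∸n≤o m u₁ hi)
                  , sym (m+[n∸m]≡n (m+n≤o⇒m≤o u₁ (<⇒≤ (≰⇒> m≰u₁+l₂))))

split-≤-+-double : ∀ {a b m} → 3 ≤ a → 1 ≤ b → 4 ≤ m → m ≤ a + (b + b) →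
                   ∃₂ λ m₁ j → (2 ≤ m₁ × m₁ ≤ a) × (1 ≤ j × j ≤ b) × m ≡ m₁ + (j + j)
split-≤-+-double {a} 3≤a (s≤s {n = b} z≤n) = split b
  where
  expand : ∀ x y → 2 + (x + (suc y + suc y)) ≡ x + (suc (suc y) + suc (suc y))
  expand = solve-∀

  shift : ∀ m₁ j → 2 + (m₁ + (j + j)) ≡ m₁ + (suc j + suc j)
  shift = solve-∀

  split : ∀ b {m} → 4 ≤ m → m ≤ a + (suc b + suc b) →
          ∃₂ λ m₁ j → (2 ≤ m₁ × m₁ ≤ a) × (1 ≤ j × j ≤ suc b) × m ≡ m₁ + (j + j)
  split zero (s≤s (s≤s {n = m} 2≤m)) m≤a+2 =
    m , 1 , (2≤m , s≤s⁻¹ (s≤s⁻¹ (≤-trans m≤a+2 (≤-reflexive (+-comm a 2))))) , (≤-refl , ≤-refl) , +-comm 2 m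
  split (suc b) {m} 4≤m m≤ with m ≤? a + (suc b + suc b)
  ... | yes m≤a+2[1+b] with split b 4≤m m≤a+2[1+b]
  ...   | m₁ , j , m₁-bounds , (1≤j , j≤1+b) , m≡ = m₁ , j , m₁-bounds , (1≤j , m≤n⇒m≤1+n j≤1+b) , m≡
  split (suc b) (s≤s (s≤s {n = m-2} _)) m≤ | no m≰a+2[1+b]
    with split b (s≤s⁻¹ (s≤s⁻¹ (≤-trans (s≤s (+-mono-≤ 3≤a (+-mono-≤ (s≤s z≤n) (s≤s z≤n)))) (≰⇒> m≰a+2[1+b]))))
                 (s≤s⁻¹ (s≤s⁻¹ (≤-trans m≤ (≤-reflexive (sym (expand a b))))))
  ... | m₁ , j , m₁-bounds , (1≤j , j≤1+b) , m-2≡ =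
    m₁ , suc j , m₁-bounds , (m≤n⇒m≤1+n 1≤j , s≤s j≤1+b) , trans (cong (2 +_) m-2≡) (shift m₁ j)

2^[1+n]≡2^n+2^n : ∀ n → 2 ^ suc n ≡ 2 ^ n + 2 ^ n
2^[1+n]≡2^n+2^n n = cong (2 ^ n +_) (+-identityʳ (2 ^ n))

data AddOne : ∀ {k} → Subset k → Subset k → Set where
  here  : ∀ {k} {S : Subset k} → AddOne (outside ∷ S) (inside ∷ S)
  there : ∀ {k s} {S S′ : Subset k} → AddOne S S′ → AddOne (s ∷ S) (s ∷ S′)

data Move : ∀ {k} → Subset k → Subset k → Set where
  add     : ∀ {k} {X Y : Subset k} → AddOne X Y → Move X Y
  remove  : ∀ {k} {X Y : Subset k} → AddOne Y X → Move X Y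
  swapOut : ∀ {k} {S S′ : Subset k} → AddOne S S′ → Move (inside ∷ S) (outside ∷ S′)
  swapIn  : ∀ {k} {S S′ : Subset k} → AddOne S S′ → Move (outside ∷ S′) (inside ∷ S)

Move-sym : ∀ {k} {X Y : Subset k} → Move X Y → Move Y X
Move-sym (add a)     = remove a
Move-sym (remove a)  = add a
Move-sym (swapOut a) = swapIn a
Move-sym (swapIn a)  = swapOut a

AddOne-insertAt : ∀ {k} {X Y : Subset k} i s → AddOne X Y → AddOne (insertAt X i s) (insertAt Y i s)
AddOne-insertAt zero    s a         = there a
AddOne-insertAt (suc i) s here      = here
AddOne-insertAt (suc i) s (there a) = there (AddOne-insertAt i s a)

Move-insertAt : ∀ {k} {X Y : Subset (suc k)} i s → Move X Y →
                Move (insertAt X (suc i) s) (insertAt Y (suc i) s)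
Move-insertAt i s (add a)     = add (AddOne-insertAt (suc i) s a)
Move-insertAt i s (remove a)  = remove (AddOne-insertAt (suc i) s a)
Move-insertAt i s (swapOut a) = swapOut (AddOne-insertAt i s a)
Move-insertAt i s (swapIn a)  = swapIn (AddOne-insertAt i s a)

insertAt-injective : ∀ {A : Set} {k} {xs ys : Vec A k} i x → insertAt xs i x ≡ insertAt ys i x → xs ≡ ys
insertAt-injective {xs = xs} {ys} i x eq = begin
  xs                           ≡⟨ removeAt-insertAt xs i x ⟨
  removeAt (insertAt xs i x) i ≡⟨ cong (λ zs → removeAt zs i) eq ⟩
  removeAt (insertAt ys i x) i ≡⟨ removeAt-insertAt ys i x ⟩
  ys                           ∎
  where open ≡-Reasoning

Allowed : ∀ {k} → (Subset k → Set) → Subset (suc k) → Set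
Allowed P (inside  ∷ S) = ⊤
Allowed P (outside ∷ S) = P S

full∖1 : ∀ {k} → Subset (2 + k)
full∖1 = inside ∷ outside ∷ full

MovePath : ∀ {k} → (Subset (suc k) → Set) → ℕ → Set
MovePath P m = Path Move (Allowed P) full full∖1 m

Allowed-insertAt : ∀ {k} {P : Subset (suc k) → Set} {Q : Subset k → Set} {s} →
                   (∀ {S} → Q S → P (s ∷ S)) → ∀ {X} → Allowed Q X → Allowed P (insertAt X (suc zero) s)
Allowed-insertAt h {inside  ∷ S} _ = tt
Allowed-insertAt h {outside ∷ S} q = h q

module _ {k} {P : Subset (2 + k) → Set} where

  MovePath-insertAt : ∀ {Q : Subset (suc k) → Set} s → (∀ {S} → Q S → P (s ∷ S)) → ∀ {m} → MovePath Q m →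
                  Path Move (λ X → Allowed P X × lookup X (suc zero) ≡ s)
                       (insertAt full (suc zero) s) (insertAt full∖1 (suc zero) s) m
  MovePath-insertAt s h = Path-map (λ X → insertAt X (suc zero) s) (insertAt-injective (suc zero) s)
                        (Move-insertAt zero s) (λ {X} q → Allowed-insertAt {P = P} h {X} q , insertAt-lookup X (suc zero) s)

  MovePath-join : ∀ {P₁ P₀ : Subset (suc k) → Set} →
                  (∀ {S} → P₁ S → P (inside ∷ S)) → (∀ {S} → P₀ S → P (outside ∷ S)) →
                  ∀ {m₁ m₀} → MovePath P₁ m₁ → MovePath P₀ m₀ → MovePath P (m₁ + m₀)
  MovePath-join h₁ h₀ p₁ p₀ = Path-weaken [ proj₁ , proj₁ ]
    (Path-join (λ (_ , ≡inside) (_ , ≡outside) → inside≢outside (trans (sym ≡inside) ≡outside))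
      (MovePath-insertAt inside h₁ p₁) (remove (there here)) (Path-reverse Move-sym (MovePath-insertAt outside h₀ p₀)))
    where
    inside≢outside : inside ≢ outside
    inside≢outside ()

Traceable : ∀ {k} → (Subset (suc k) → Set) → ℕ → Set
Traceable P N = ∀ {m} → 2 ≤ m → m ≤ N → MovePath P m

module _ {k} {P : Subset (suc k) → Set} where

  MovePath-2 : MovePath P 2
  MovePath-2 = path (full ∷⟨ remove (there here) ⟩ end full∖1) refl
    (((λ ()) ∷ []) ∷ [] ∷ []) (tt ∷ tt ∷ [])

  MovePath-3 : P full → MovePath P 3
  MovePath-3 p = path (full ∷⟨ remove here ⟩ (outside ∷ full) ∷⟨ swapIn here ⟩ end full∖1) refl
    (((λ ()) ∷ (λ ()) ∷ []) ∷ ((λ ()) ∷ []) ∷ [] ∷ []) (tt ∷ p ∷ tt ∷ [])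

  traceable : ∀ {N} → P full → (∀ {m} → 4 ≤ m → m ≤ N → MovePath P m) → Traceable P N
  traceable p long {1} (s≤s ()) _
  traceable p long {2} _ _   = MovePath-2
  traceable p long {3} _ _   = MovePath-3 p
  traceable p long {suc (suc (suc (suc m)))} _ m≤N = long (s≤s (s≤s (s≤s (s≤s z≤n)))) m≤N

MovePath-4 : MovePath {0} (λ _ → ⊤) 4
MovePath-4 = path
  (full ∷⟨ remove here ⟩ (outside ∷ inside ∷ []) ∷⟨ remove (there here) ⟩ (outside ∷ outside ∷ [])
        ∷⟨ add here ⟩ end full∖1)
  refl
  (((λ ()) ∷ (λ ()) ∷ (λ ()) ∷ []) ∷ ((λ ()) ∷ (λ ()) ∷ []) ∷ ((λ ()) ∷ []) ∷ [] ∷ [])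
  (tt ∷ tt ∷ tt ∷ tt ∷ [])

hypercube-paths : ∀ k {j} → 1 ≤ j → j ≤ 2 ^ k → MovePath {k} (λ _ → ⊥) (j + j)
hypercube-paths k       {1}                _ _          = MovePath-2
hypercube-paths zero    {suc (suc j)}      _ (s≤s ())
hypercube-paths (suc k) {j@(suc (suc _))}  _ j≤2^[1+k] =
  let j₁ , j₀ , (1≤j₁ , j₁≤2^k) , (1≤j₀ , j₀≤2^k) , j≡ =
        split-≤-+ (m^n>0 2 k) (m^n>0 2 k) (s≤s (s≤s z≤n)) (≤-trans j≤2^[1+k] (≤-reflexive (2^[1+n]≡2^n+2^n k)))
  in Path-cast (trans (interchange j₁ j₁ j₀ j₀) (cong (λ x → x + x) (sym j≡)))
       (MovePath-join (λ ()) (λ ()) (hypercube-paths k 1≤j₁ j₁≤2^k) (hypercube-paths k 1≤j₀ j₀≤2^k))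

full-traceable : ∀ k → Traceable {k} (λ _ → ⊤) (2 ^ (2 + k))
full-traceable zero    = traceable tt λ 4≤m m≤4 → Path-cast (≤-antisym 4≤m m≤4) MovePath-4
full-traceable (suc k) = traceable tt λ 4≤m m≤2^[3+k] →
  let m₁ , m₀ , (2≤m₁ , m₁≤2^[2+k]) , (2≤m₀ , m₀≤2^[2+k]) , m≡ =
        split-≤-+ 2≤2^[2+k] 2≤2^[2+k] 4≤m (≤-trans m≤2^[3+k] (≤-reflexive (2^[1+n]≡2^n+2^n (2 + k))))
  in Path-cast (sym m≡)
       (MovePath-join (λ _ → tt) (λ _ → tt) (full-traceable k 2≤m₁ m₁≤2^[2+k]) (full-traceable k 2≤m₀ m₀≤2^[2+k]))
  where
  2≤2^[2+k] : 2 ≤ 2 ^ (2 + k)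
  2≤2^[2+k] = ^-monoʳ-≤ 2 {1} {2 + k} (s≤s z≤n)

thrAdj-sym : ∀ {n} (t : ThrSeq n) {i j} → thrAdj t i j → thrAdj t j i
thrAdj-sym (isolated t)  {suc i} {suc j} a = thrAdj-sym t a
thrAdj-sym (universal t) {zero}  {suc j} a = tt
thrAdj-sym (universal t) {suc i} {zero}  a = tt
thrAdj-sym (universal t) {suc i} {suc j} a = thrAdj-sym t a

thrAdj-irrefl : ∀ {n} (t : ThrSeq n) {i} → ¬ thrAdj t i i
thrAdj-irrefl single        ()
thrAdj-irrefl (isolated t)  {suc i} a = thrAdj-irrefl t a
thrAdj-irrefl (universal t) {suc i} a = thrAdj-irrefl t a

thrGraph : ∀ {n} → ThrSeq n → Graph n
thrGraph t = record { Adj = thrAdj t ; sym = thrAdj-sym t ; irrefl = thrAdj-irrefl t }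

ThrDominating : ∀ {n} → ThrSeq n → Subset n → Set
ThrDominating single        (s ∷ []) = s ≡ inside
ThrDominating (isolated t)  (s ∷ S)  = s ≡ inside × ThrDominating t S
ThrDominating (universal t) X        = Allowed (ThrDominating t) X

ThrDominating-full : ∀ {n} (t : ThrSeq n) → ThrDominating t full
ThrDominating-full single        = refl
ThrDominating-full (isolated t)  = refl , ThrDominating-full t
ThrDominating-full (universal t) = tt

ThrDominating⇒Nonempty : ∀ {n} (t : ThrSeq n) {S} → ThrDominating t S → Nonempty S
ThrDominating⇒Nonempty single        {inside  ∷ _} _ = zero , here
ThrDominating⇒Nonempty single        {outside ∷ []} ()
ThrDominating⇒Nonempty (isolated t)  {inside  ∷ _} _ = zero , here
ThrDominating⇒Nonempty (universal t) {inside  ∷ _} _ = zero , here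
ThrDominating⇒Nonempty (universal t) {outside ∷ _} d with ThrDominating⇒Nonempty t d
... | u , u∈S = suc u , there u∈S

Dominating-tail : ∀ {n} (G : Graph n) (H : Graph (suc n)) {s S} →
                  (∀ {u v} → Adj H (suc u) (suc v) → Adj G u v) →
                  (∀ {v} → zero ∈ s ∷ S → ¬ Adj H zero (suc v)) →
                  Dominating H (s ∷ S) → Dominating G S
Dominating-tail G H restrict zero-idle d v v∉S with d (suc v) (λ { (there v∈S) → v∉S v∈S })
... | zero  , zero∈ , a       = ⊥-elim (zero-idle zero∈ a)
... | suc u , there u∈S , a = u , u∈S , restrict a

Dominating⇒ThrDominating : ∀ {n} (t : ThrSeq n) D → Dominating (thrGraph t) D → ThrDominating t D
Dominating⇒ThrDominating single (inside ∷ []) _ = refl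
Dominating⇒ThrDominating single (outside ∷ []) d with d zero (λ ())
... | zero , () , _
Dominating⇒ThrDominating (isolated t) (outside ∷ S) d with d zero (λ ())
... | suc _ , _ , ()
Dominating⇒ThrDominating (isolated t) (inside ∷ S) d =
  refl , Dominating⇒ThrDominating t S (Dominating-tail (thrGraph t) (thrGraph (isolated t)) id (λ _ ()) d)
Dominating⇒ThrDominating (universal t) (inside ∷ S)  _ = tt
Dominating⇒ThrDominating (universal t) (outside ∷ S) d =
  Dominating⇒ThrDominating t S (Dominating-tail (thrGraph t) (thrGraph (universal t)) id (λ ()) d)

ThrDominating⇒Dominating : ∀ {n} (t : ThrSeq n) D → ThrDominating t D → Dominating (thrGraph t) D
ThrDominating⇒Dominating single        (inside ∷ []) _ zero v∉ = ⊥-elim (v∉ here)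
ThrDominating⇒Dominating (isolated t)  (inside ∷ S) _ zero v∉ = ⊥-elim (v∉ here)
ThrDominating⇒Dominating (isolated t)  (inside ∷ S) (_ , d) (suc v) v∉
  with ThrDominating⇒Dominating t S d v (λ v∈S → v∉ (there v∈S))
... | u , u∈S , a = suc u , there u∈S , a
ThrDominating⇒Dominating (universal t) (inside ∷ S)  _ zero v∉ = ⊥-elim (v∉ here)
ThrDominating⇒Dominating (universal t) (inside ∷ S)  _ (suc v) _ = zero , here , tt
ThrDominating⇒Dominating (universal t) (outside ∷ S) d zero _ with ThrDominating⇒Nonempty t d
... | u , u∈S = suc u , there u∈S , tt
ThrDominating⇒Dominating (universal t) (outside ∷ S) d (suc v) v∉
  with ThrDominating⇒Dominating t S d v (λ v∈S → v∉ (there v∈S))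
... | u , u∈S , a = suc u , there u∈S , a

domCount : ∀ {n} → ThrSeq n → ℕ
domCount single            = 1
domCount (isolated t)      = domCount t
domCount (universal {n} t) = 2 ^ n + domCount t

subsets : ∀ n → List (Subset n)
subsets zero    = [] ∷ []
subsets (suc n) = map (inside ∷_) (subsets n) ++ map (outside ∷_) (subsets n)

dominatingSets : ∀ {n} → ThrSeq n → List (Subset n)
dominatingSets single            = full ∷ []
dominatingSets (isolated t)      = map (inside ∷_) (dominatingSets t)
dominatingSets (universal {n} t) = map (inside ∷_) (subsets n) ++ map (outside ∷_) (dominatingSets t)

length-map-++ : ∀ {A B : Set} (f g : A → B) (xs ys : List A) →
                length (map f xs ++ map g ys) ≡ length xs + length ys
length-map-++ f g xs ys = trans (length-++ (map f xs)) (cong₂ _+_ (length-map f xs) (length-map g ys))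

length-subsets : ∀ n → length (subsets n) ≡ 2 ^ n
length-subsets zero    = refl
length-subsets (suc n) = begin
  length (subsets (suc n))                 ≡⟨ length-map-++ (inside ∷_) (outside ∷_) (subsets n) (subsets n) ⟩
  length (subsets n) + length (subsets n)  ≡⟨ cong₂ _+_ (length-subsets n) (length-subsets n) ⟩
  2 ^ n + 2 ^ n                            ≡⟨ 2^[1+n]≡2^n+2^n n ⟨
  2 ^ suc n                                ∎
  where open ≡-Reasoning

∈-subsets : ∀ {n} (S : Subset n) → S List.∈ subsets n
∈-subsets []            = here refl
∈-subsets (inside ∷ S)  = ∈-++⁺ˡ (∈-map⁺ (inside ∷_) (∈-subsets S))
∈-subsets (outside ∷ S) = ∈-++⁺ʳ _ (∈-map⁺ (outside ∷_) (∈-subsets S))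

length-dominatingSets : ∀ {n} (t : ThrSeq n) → length (dominatingSets t) ≡ domCount t
length-dominatingSets single            = refl
length-dominatingSets (isolated t)      = trans (length-map (inside ∷_) (dominatingSets t)) (length-dominatingSets t)
length-dominatingSets (universal {n} t) =
  trans (length-map-++ (inside ∷_) (outside ∷_) (subsets n) (dominatingSets t))
        (cong₂ _+_ (length-subsets n) (length-dominatingSets t))

∈-dominatingSets : ∀ {n} (t : ThrSeq n) {D} → ThrDominating t D → D List.∈ dominatingSets t
∈-dominatingSets single        {inside  ∷ []} _        = here refl
∈-dominatingSets (isolated t)  {inside  ∷ S}  (_ , d)  = ∈-map⁺ (inside ∷_) (∈-dominatingSets t d)
∈-dominatingSets (universal t) {inside  ∷ S}  _        = ∈-++⁺ˡ (∈-map⁺ (inside ∷_) (∈-subsets S))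
∈-dominatingSets (universal t) {outside ∷ S}  d        = ∈-++⁺ʳ _ (∈-map⁺ (outside ∷_) (∈-dominatingSets t d))

domCount-positive : ∀ {n} (t : ThrSeq n) → 1 ≤ domCount t
domCount-positive single            = s≤s z≤n
domCount-positive (isolated t)      = domCount-positive t
domCount-positive (universal {n} t) = ≤-trans (domCount-positive t) (m≤n+m (domCount t) (2 ^ n))

dominating-traceable : ∀ {k} (t : ThrSeq (suc k)) → Traceable (ThrDominating t) (2 ^ suc k + domCount t)
dominating-traceable single = traceable refl λ 4≤m m≤3 → ⊥-elim (<-irrefl refl (≤-trans 4≤m m≤3))
dominating-traceable {suc k} (isolated t) = traceable (refl , ThrDominating-full t) λ 4≤m m≤N →
  let m₁ , j , (2≤m₁ , m₁≤N′) , (1≤j , j≤2^k) , m≡ =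
        split-≤-+-double 3≤N′ (m^n>0 2 k) 4≤m (≤-trans m≤N (≤-reflexive N≡N′+2^[1+k]))
  in Path-cast (sym m≡)
       (MovePath-join (refl ,_) (λ ()) (dominating-traceable t 2≤m₁ m₁≤N′) (hypercube-paths k 1≤j j≤2^k))
  where
  3≤N′ : 3 ≤ 2 ^ suc k + domCount t
  3≤N′ = +-mono-≤ (^-monoʳ-≤ 2 {1} {suc k} (s≤s z≤n)) (domCount-positive t)
  N≡N′+2^[1+k] : 2 ^ (2 + k) + domCount t ≡ (2 ^ suc k + domCount t) + (2 ^ k + 2 ^ k)
  N≡N′+2^[1+k] = begin
    2 ^ (2 + k) + domCount t                   ≡⟨ cong (_+ domCount t) (2^[1+n]≡2^n+2^n (suc k)) ⟩
    (2 ^ suc k + 2 ^ suc k) + domCount t       ≡⟨ xy∙z≈xz∙y (2 ^ suc k) (2 ^ suc k) (domCount t) ⟩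
    (2 ^ suc k + domCount t) + 2 ^ suc k       ≡⟨ cong ((2 ^ suc k + domCount t) +_) (2^[1+n]≡2^n+2^n k) ⟩
    (2 ^ suc k + domCount t) + (2 ^ k + 2 ^ k) ∎
    where open ≡-Reasoning
dominating-traceable {suc k} (universal t) = traceable tt λ 4≤m m≤N →
  let m₁ , m₀ , (2≤m₁ , m₁≤2^[2+k]) , (2≤m₀ , m₀≤N′) , m≡ =
        split-≤-+ 2≤2^[2+k] 2≤N′ 4≤m m≤N
  in Path-cast (sym m≡)
       (MovePath-join (λ _ → tt) (λ d → d) (full-traceable k 2≤m₁ m₁≤2^[2+k]) (dominating-traceable t 2≤m₀ m₀≤N′))
  where
  2≤2^[2+k] : 2 ≤ 2 ^ (2 + k)
  2≤2^[2+k] = ^-monoʳ-≤ 2 {1} {2 + k} (s≤s z≤n)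
  2≤N′ : 2 ≤ 2 ^ suc k + domCount t
  2≤N′ = ≤-trans (^-monoʳ-≤ 2 {1} {suc k} (s≤s z≤n)) (m≤m+n (2 ^ suc k) (domCount t))

AddOne⇒≡∪⁅⁆ : ∀ {n} {X Y : Subset n} → AddOne X Y → ∃[ v ] (v ∉ X × v ∈ Y × Y ≡ X ∪ ⁅ v ⁆)
AddOne⇒≡∪⁅⁆ {X = outside ∷ S} here = zero , (λ ()) , here , cong (inside ∷_) (sym (∪-identityʳ S))
AddOne⇒≡∪⁅⁆ {X = s ∷ S} (there a) with AddOne⇒≡∪⁅⁆ a
... | v , v∉S , v∈S′ , S′≡ = suc v , (λ { (there v∈S) → v∉S v∈S }) , there v∈S′ , cong₂ _∷_ (sym (∨-identityʳ s)) S′≡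

module _ {n} (G : Graph n) where

  TarsAdj-sym : ∀ {X Y} → TarsAdj G X Y → TarsAdj G Y X
  TarsAdj-sym (X≢Y , step) = X≢Y ∘ sym , ⊎-swap step

  AddOne⇒TarsAdj : ∀ {X Y} → AddOne X Y → TarsAdj G X Y
  AddOne⇒TarsAdj a with AddOne⇒≡∪⁅⁆ a
  ... | v , v∉X , v∈Y , Y≡ = (λ { refl → v∉X v∈Y }) , inj₁ (inj₁ (v , v∉X , Y≡))

module _ {n} (t : ThrSeq n) where

  private
    U = thrGraph (universal t)

  swapOut⇒TarsAdj : ∀ {S S′} → AddOne S S′ → TarsAdj U (inside ∷ S) (outside ∷ S′)
  swapOut⇒TarsAdj a with AddOne⇒≡∪⁅⁆ a
  ... | v , v∉S , v∈S′ , S′≡ = (λ ()) , inj₁ (inj₂ (inj₂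
    (zero , suc v , here , there v∈S′ , (λ { (there v∈S) → v∉S v∈S }) , tt ,
     cong (outside ∷_) (trans S′≡ (sym (p─⊥≡p _))))))

  Move⇒TarsAdj : ∀ {X Y} → Move X Y → TarsAdj U X Y
  Move⇒TarsAdj (add a)     = AddOne⇒TarsAdj U a
  Move⇒TarsAdj (remove a)  = TarsAdj-sym U (AddOne⇒TarsAdj U a)
  Move⇒TarsAdj (swapOut a) = swapOut⇒TarsAdj a
  Move⇒TarsAdj (swapIn a)  = TarsAdj-sym U (swapOut⇒TarsAdj a)

Path⇒TarsCycle : ∀ {n} {G : Graph n} {a b m} → Path (TarsAdj G) (Dominating G) a b (suc m) → TarsAdj G b a →
                 TarsCycle G m
Path⇒TarsCycle {G = G} (path w len u ds) b~a = subst (TarsCycle G) (suc-injective (trans (sym (length-vertices w)) len))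
  record
    { c     = vertexAt w
    ; dom   = λ i → All.lookup ds (vertexAt-∈ w i)
    ; inj   = λ i j → vertexAt-injective w u
    ; step  = vertexAt-step w
    ; close = subst₂ (TarsAdj G) (sym (vertexAt-last w)) (sym (vertexAt-zero w)) b~a
    }

module _ {n} (G : Graph n) (H : Graph (suc n)) (lift-adj : ∀ {u v} → Adj G u v → Adj H (suc u) (suc v)) where

  TarsStep-∷ : ∀ s {X Y} → TarsStep G X Y → TarsStep H (s ∷ X) (s ∷ Y)
  TarsStep-∷ s (inj₁ (v , v∉X , refl)) =
    inj₁ (suc v , (λ { (there v∈X) → v∉X v∈X }) , cong (_∷ _) (sym (∨-identityʳ s)))
  TarsStep-∷ s (inj₂ (inj₁ (v , v∈X , refl))) =
    inj₂ (inj₁ (suc v , there v∈X , refl))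
  TarsStep-∷ s (inj₂ (inj₂ (u , v , u∈X , v∈Y , v∉X , u~v , refl))) =
    inj₂ (inj₂ (suc u , suc v , there u∈X , there v∈Y , (λ { (there v∈X) → v∉X v∈X }) , lift-adj u~v ,
                cong (_∷ _) (sym (∨-identityʳ s))))

  TarsAdj-∷ : ∀ s {X Y} → TarsAdj G X Y → TarsAdj H (s ∷ X) (s ∷ Y)
  TarsAdj-∷ s (X≢Y , step) = X≢Y ∘ ∷-injectiveʳ , ⊎-map (TarsStep-∷ s) (TarsStep-∷ s) step

TarsCycle-isolated : ∀ {n} (t : ThrSeq n) {m} → TarsCycle (thrGraph t) m → TarsCycle (thrGraph (isolated t)) m
TarsCycle-isolated t C = record
  { c     = λ i → inside ∷ c i
  ; dom   = λ i → ThrDominating⇒Dominating (isolated t) _ (refl , Dominating⇒ThrDominating t _ (dom i))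
  ; inj   = λ i j → inj i j ∘ ∷-injectiveʳ
  ; step  = λ i → TarsAdj-∷ (thrGraph t) (thrGraph (isolated t)) id inside (step i)
  ; close = TarsAdj-∷ (thrGraph t) (thrGraph (isolated t)) id inside close
  }
  where open TarsCycle C

threshold-cycle : ∀ {n} (t : ThrSeq n) {m} → 3 ≤ suc m → suc m ≤ domCount t → TarsCycle (thrGraph t) m
threshold-cycle single        (s≤s ()) (s≤s z≤n)
threshold-cycle (isolated t)  3≤1+m 1+m≤N = TarsCycle-isolated t (threshold-cycle t 3≤1+m 1+m≤N)
threshold-cycle (universal {zero} ())
threshold-cycle (universal {suc _} t) (s≤s 2≤m) 1+m≤N = Path⇒TarsCycle
  (Path-map id id (Move⇒TarsAdj t) (λ {X} → ThrDominating⇒Dominating (universal t) X)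
    (dominating-traceable t (m≤n⇒m≤1+n 2≤m) 1+m≤N))
  (Move⇒TarsAdj t (add (there here)))

record _≅_ {n} (G H : Graph n) : Set where
  field
    bijection : Fin n ↔ Fin n
    adjacent  : ∀ i j → Adj G i j ⇔ Adj H (Inverse.to bijection i) (Inverse.to bijection j)

≅-sym : ∀ {n} {G H : Graph n} → G ≅ H → H ≅ G
≅-sym {G = G} {H} φ = record
  { bijection = ↔-sym bijection
  ; adjacent  = λ i j → ⇔-sym (subst₂ (λ x y → Adj G (from i) (from j) ⇔ Adj H x y)
                                       (strictlyInverseˡ i) (strictlyInverseˡ j) (adjacent (from i) (from j)))
  }
  where open _≅_ φ; open Inverse bijection

module Transport {n} {G H : Graph n} (φ : G ≅ H) where

  open _≅_ φ
  open Inverse bijection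

  image : Subset n → Subset n
  image X = tabulate (lookup X ∘ from)

  lookup-image-to : ∀ X i → lookup (image X) (to i) ≡ lookup X i
  lookup-image-to X i = trans (lookup∘tabulate (lookup X ∘ from) (to i)) (cong (lookup X) (strictlyInverseʳ i))

  to-∈-image : ∀ {X i} → i ∈ X → to i ∈ image X
  to-∈-image {X} {i} i∈X = lookup⇒[]= (to i) (image X) (trans (lookup-image-to X i) ([]=⇒lookup i∈X))

  to-∈-image⁻ : ∀ {X i} → to i ∈ image X → i ∈ X
  to-∈-image⁻ {X} {i} i∈X = lookup⇒[]= i X (trans (sym (lookup-image-to X i)) ([]=⇒lookup i∈X))

  ∈-image⁻ : ∀ {X j} → j ∈ image X → from j ∈ X
  ∈-image⁻ {X} {j} j∈ = to-∈-image⁻ (subst (_∈ image X) (sym (strictlyInverseˡ j)) j∈)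

  image-injective : ∀ {X Y} → image X ≡ image Y → X ≡ Y
  image-injective {X} {Y} eq = Pointwise-≡⇒≡ (ext λ i → begin
    lookup X i              ≡⟨ lookup-image-to X i ⟨
    lookup (image X) (to i) ≡⟨ cong (λ Z → lookup Z (to i)) eq ⟩
    lookup (image Y) (to i) ≡⟨ lookup-image-to Y i ⟩
    lookup Y i              ∎)
    where open ≡-Reasoning

  image-zipWith : ∀ {f} X Y → image (zipWith f X Y) ≡ zipWith f (image X) (image Y)
  image-zipWith {f} X Y = Pointwise-≡⇒≡ (ext λ j → begin
    lookup (image (zipWith f X Y)) j            ≡⟨ lookup∘tabulate _ j ⟩
    lookup (zipWith f X Y) (from j)             ≡⟨ lookup-zipWith f (from j) X Y ⟩
    f (lookup X (from j)) (lookup Y (from j))   ≡⟨ cong₂ f (lookup∘tabulate _ j) (lookup∘tabulate _ j) ⟨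
    f (lookup (image X) j) (lookup (image Y) j) ≡⟨ lookup-zipWith f j (image X) (image Y) ⟨
    lookup (zipWith f (image X) (image Y)) j    ∎)
    where open ≡-Reasoning

  image-⁅⁆ : ∀ v → image ⁅ v ⁆ ≡ ⁅ to v ⁆
  image-⁅⁆ v = ⊆-antisym
    (λ {j} j∈ → subst (_∈ ⁅ to v ⁆) (trans (sym (cong to (x∈⁅y⁆⇒x≡y v (∈-image⁻ j∈)))) (strictlyInverseˡ j)) (x∈⁅x⁆ (to v)))
    (λ {j} j∈ → subst (_∈ image ⁅ v ⁆) (sym (x∈⁅y⁆⇒x≡y (to v) j∈)) (to-∈-image (x∈⁅x⁆ v)))

  image-∪⁅⁆ : ∀ X v → image (X ∪ ⁅ v ⁆) ≡ image X ∪ ⁅ to v ⁆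
  image-∪⁅⁆ X v = trans (image-zipWith X ⁅ v ⁆) (cong (image X ∪_) (image-⁅⁆ v))

  image-─⁅⁆ : ∀ X v → image (X - v) ≡ image X - to v
  image-─⁅⁆ X v = trans (image-zipWith X ⁅ v ⁆) (cong (image X ─_) (image-⁅⁆ v))

  to-adjacent : ∀ {u v} → Adj G u v → Adj H (to u) (to v)
  to-adjacent {u} {v} = Equivalence.to (adjacent u v)

  image-Dominating : ∀ {X} → Dominating G X → Dominating H (image X)
  image-Dominating {X} d j j∉ with d (from j) (λ from-j∈X → j∉ (subst (_∈ image X) (strictlyInverseˡ j) (to-∈-image from-j∈X)))
  ... | u , u∈X , u~ = to u , to-∈-image u∈X , subst (Adj H (to u)) (strictlyInverseˡ j) (to-adjacent u~)

  image-TarsStep : ∀ {X Y} → TarsStep G X Y → TarsStep H (image X) (image Y)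
  image-TarsStep {X} (inj₁ (v , v∉X , refl)) = inj₁ (to v , v∉X ∘ to-∈-image⁻ , image-∪⁅⁆ X v)
  image-TarsStep {X} (inj₂ (inj₁ (v , v∈X , refl))) = inj₂ (inj₁ (to v , to-∈-image v∈X , image-─⁅⁆ X v))
  image-TarsStep {X} (inj₂ (inj₂ (u , v , u∈X , v∈Y , v∉X , u~v , refl))) =
    inj₂ (inj₂ (to u , to v , to-∈-image u∈X , to-∈-image v∈Y , v∉X ∘ to-∈-image⁻ , to-adjacent u~v ,
                trans (image-─⁅⁆ (X ∪ ⁅ v ⁆) u) (cong (_- to u) (image-∪⁅⁆ X v))))

  image-TarsAdj : ∀ {X Y} → TarsAdj G X Y → TarsAdj H (image X) (image Y)
  image-TarsAdj (X≢Y , inj₁ step) = X≢Y ∘ image-injective , inj₁ (image-TarsStep step)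
  image-TarsAdj (X≢Y , inj₂ step) = X≢Y ∘ image-injective , inj₂ (image-TarsStep step)

  image-TarsCycle : ∀ {m} → TarsCycle G m → TarsCycle H m
  image-TarsCycle C = record
    { c     = image ∘ c
    ; dom   = image-Dominating ∘ dom
    ; inj   = λ i j → inj i j ∘ image-injective
    ; step  = image-TarsAdj ∘ step
    ; close = image-TarsAdj close
    }
    where open TarsCycle C

EnumDom⇒length≤domCount : ∀ {n} {G : Graph n} (t : ThrSeq n) → G ≅ thrGraph t →
                          ∀ {L} → EnumDom G L → length L ≤ domCount t
EnumDom⇒length≤domCount t φ {L} (unique , enumerates) = begin
  length L                  ≡⟨ length-map image L ⟨
  length (map image L)      ≤⟨ Unique-⊆⇒length-≤ (Unique.map⁺ image-injective unique) image-L⊆dominatingSets ⟩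
  length (dominatingSets t) ≡⟨ length-dominatingSets t ⟩
  domCount t                ∎
  where
  open Transport φ
  open ≤-Reasoning
  image-L⊆dominatingSets : ∀ {Y} → Y List.∈ map image L → Y List.∈ dominatingSets t
  image-L⊆dominatingSets Y∈ with ∈-map⁻ image Y∈
  ... | X , X∈L , refl = ∈-dominatingSets t (Dominating⇒ThrDominating t _ (image-Dominating (Equivalence.to (enumerates X) X∈L)))

mainTheorem10 : ∀ (n : ℕ) (G : Graph n) → IsThreshold G → TarsPancyclic G
mainTheorem10 n G (t , π , adjacent) L enumeration m 3≤1+m 1+m≤|L| =
  Transport.image-TarsCycle (≅-sym φ)
    (threshold-cycle t 3≤1+m (≤-trans 1+m≤|L| (EnumDom⇒length≤domCount t φ enumeration)))
  where
  φ : G ≅ thrGraph t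
  φ = record { bijection = π ; adjacent = adjacent }
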